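{- Consider Algorithm 1 below run on an instance with an $\alpha$-estimation $\mathsf{opt}_\alpha$. If the algorithm selects a value $p$ and its output $S$ satisfies $|S|\ge |OPT_{p+3}|/[2(d+1)]$, then $f(S)\ge w(OPT_{p+3})/[32(d+1)^2]$.
   Context: $\mathcal N$ is a finite ground set, $f:2^{\mathcal N}\to\mathbb R_{\ge0}$ is a monotone set function with $f(\varnothing)=0$, and $M=(\mathcal N,\mathcal I)$ is a matroid of rank $k$; $OPT$ is an independent set maximizing $f$. $f(u\mid S)=f(S\cup\{u\})-f(S)$. $\mathcal D^+(u)=\{v\in\mathcal N:\exists S\subseteq\mathcal N,\ f(u\mid S\cup\{v\})>f(u\mid S)\}$ and $d=\max_u|\mathcal D^+(u)|$ is the supermodular degree. Elements arrive in some order; $\mathcal N_u$ is the set of elements arriving up to and including $u$. $\alpha\ge1$ and $\mathsf{opt}_\alpha$ satisfies $f(OPT)/\alpha\le\mathsf{opt}_\alpha\le f(OPT)$. For $u\in OPT$, $w(u)=f(u\mid OPT\setminus\mathcal N_u)$, extended additively to subsets of $OPT$, and for every integer $p$, $OPT_p=\{u\in OPT:2^p\mathsf{opt}_\alpha/2\le w(u)\le 2^p\mathsf{opt}_\alpha\}$. Algorithm 1: choose $p$ uniformly at random from the integers $\{ -\lceil\log_2k\rceil-3,\dots,\lceil\log_2\alpha\rceil\}$; set $\tau=2^p\cdot\mathsf{opt}_\alpha/2$ and $S=\varnothing$; for each arriving element $u$ in order, if there is a set $D\subseteq\mathcal D^+(u)\setminus\mathcal N_u$ with $f(u\mid D\cup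 S)\ge\tau$ and $S\cup D\cup\{u\}\in\mathcal I$, then add $D\cup\{u\}$ to $S$ (the elements of $D$ are accepted when they arrive); finally return $S$.
   Formalization: The set function f takes nonnegative rational values instead of values in $\mathbb R_{\ge0}$, and the parameters α and $\mathsf{opt}_\alpha$ are rational. -}

module Defs where

open import Data.Nat as ℕ using (ℕ; zero; suc; _⊔_)
open import Data.Integer as ℤ using (ℤ; +_; -[1+_])
open import Data.Rational as ℚ using (ℚ; 0ℚ; 1ℚ; ½; _+_; _-_; _*_; _≤_; _<_)
open import Data.Rational.Properties using (_≤?_; _<?_)
open import Data.Fin using (Fin)
open import Data.Fin.Subset using (Subset; _∈_; _∉_; _∪_; ⁅_⁆; ∣_∣; ⊥; _⊆_; _─_)
open import Data.Fin.Subset.Properties using (anySubset?)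
open import Data.Fin.Permutation using (Permutation′; _⟨$⟩ˡ_; _⟨$⟩ʳ_)
open import Data.Fin.Properties using () renaming (_≤?_ to _≤ᶠ?_)
open import Data.Vec using (tabulate; lookup)
open import Data.List using (List; []; _∷_; foldr; allFin; map)
open import Data.Bool using (Bool; true; false; if_then_else_; _∧_)
open import Data.Product using (Σ; ∃; _×_; _,_)
open import Relation.Nullary using (¬_)
open import Relation.Nullary.Decidable using (isYes)
open import Relation.Binary.PropositionalEquality using (_≡_)

marg : ∀ {n} → (Subset n → ℚ) → Fin n → Subset n → ℚ
marg f u S = f (S ∪ ⁅ u ⁆) - f S

Monotone : ∀ {n} → (Subset n → ℚ) → Set
Monotone {n} f = ∀ (A B : Subset n) → A ⊆ B → f A ≤ f B

record IsMatroid {n : ℕ} (Indep : Subset n → Set) : Set where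
  field
    indep-∅    : Indep ⊥
    indep-down : ∀ A B → A ⊆ B → Indep B → Indep A
    exchange   : ∀ A B → Indep A → Indep B → ∣ A ∣ ℕ.< ∣ B ∣ →
                 ∃ λ x → x ∈ B × x ∉ A × Indep (A ∪ ⁅ x ⁆)

HasRank : ∀ {n} → (Subset n → Set) → ℕ → Set
HasRank {n} Indep k =
  (∃ λ B → Indep B × ∣ B ∣ ≡ k) × (∀ (A : Subset n) → Indep A → ∣ A ∣ ℕ.≤ k)

IsOPT : ∀ {n} → (Subset n → Set) → (Subset n → ℚ) → Subset n → Set
IsOPT {n} Indep f O = Indep O × (∀ (A : Subset n) → Indep A → f A ≤ f O)

Dplus : ∀ {n} → (Subset n → ℚ) → Fin n → Subset n
Dplus f u = tabulate λ v →
  isYes (anySubset? (λ S → marg f u S <? marg f u (S ∪ ⁅ v ⁆)))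

supDeg : ∀ {n} → (Subset n → ℚ) → ℕ
supDeg {n} f = foldr (λ u m → ∣ Dplus f u ∣ ⊔ m) 0 (allFin n)

pow2ℕ : ℕ → ℚ
pow2ℕ zero    = 1ℚ
pow2ℕ (suc m) = ((+ 2) ℚ./ 1) * pow2ℕ m

halfPow : ℕ → ℚ           -- halfPow m = 2^{-(m+1)}
halfPow zero    = ½
halfPow (suc m) = ½ * halfPow m

pow2 : ℤ → ℚ
pow2 (+ m)     = pow2ℕ m
pow2 -[1+ m ]  = halfPow m

IsCeilLog2 : ℚ → ℤ → Set
IsCeilLog2 α c = α ≤ pow2 c × pow2 (c ℤ.- + 1) < α

-- arrival order: π ⟨$⟩ʳ i is the element arriving at time i, π ⟨$⟩ˡ u the time of u.
-- 𝒩_u = elements arriving up to and including u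
arrivedBy : ∀ {n} → Permutation′ n → Fin n → Subset n
arrivedBy π u = tabulate λ v → isYes ((π ⟨$⟩ˡ v) ≤ᶠ? (π ⟨$⟩ˡ u))

sumOver : ∀ {n} → Subset n → (Fin n → ℚ) → ℚ
sumOver {n} T g = foldr (λ u acc → if lookup T u then g u + acc else acc) 0ℚ (allFin n)

wt : ∀ {n} → (Subset n → ℚ) → Permutation′ n → Subset n → Fin n → ℚ
wt f π O u = marg f u (O ─ arrivedBy π u)

OPTlevel : ∀ {n} → (Subset n → ℚ) → Permutation′ n → Subset n → ℚ → ℤ → Subset n
OPTlevel f π O optα q = tabulate λ u →
  lookup O u ∧ isYes ((pow2 q * optα * ½) ≤? wt f π O u)
             ∧ isYes (wt f π O u ≤? (pow2 q * optα))

GoodD : ∀ {n} → (Subset n → Set) → (Subset n → ℚ) → Permutation′ n → ℚ →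
        Fin n → Subset n → Subset n → Set
GoodD Indep f π τ u S D =
  D ⊆ (Dplus f u ─ arrivedBy π u) × τ ≤ marg f u (D ∪ S) × Indep (S ∪ D ∪ ⁅ u ⁆)

data AlgStep {n} (Indep : Subset n → Set) (f : Subset n → ℚ) (π : Permutation′ n)
             (τ : ℚ) (u : Fin n) (S : Subset n) : Subset n → Set where
  add  : (D : Subset n) → GoodD Indep f π τ u S D → AlgStep Indep f π τ u S (S ∪ D ∪ ⁅ u ⁆)
  skip : ¬ (∃ λ D → GoodD Indep f π τ u S D) → AlgStep Indep f π τ u S S

data AlgRun {n} (Indep : Subset n → Set) (f : Subset n → ℚ) (π : Permutation′ n)
            (τ : ℚ) : List (Fin n) → Subset n → Subset n → Set where
  done : ∀ {S} → AlgRun Indep f π τ [] S S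
  next : ∀ {u us S S' S''} → AlgStep Indep f π τ u S S' →
         AlgRun Indep f π τ us S' S'' → AlgRun Indep f π τ (u ∷ us) S S''

arrivals : ∀ {n} → Permutation′ n → List (Fin n)
arrivals {n} π = map (π ⟨$⟩ʳ_) (allFin n)

Algorithm1Output : ∀ {n} → (Subset n → Set) → (Subset n → ℚ) → Permutation′ n →
                   ℚ → ℤ → Subset n → Set
Algorithm1Output Indep f π optα p S =
  AlgRun Indep f π (pow2 p * optα * ½) (arrivals π) ⊥ S

{-# OPTIONS --safe #-}
-- Whenever Algorithm 1 accepts an element u it adds D ∪ {u}, at most d + 1 elements since
-- D ⊆ 𝒟⁺(u), and by monotonicity raises f by at least τ = 2^p·optα/2; hence τ|S| ≤ (d+1) f(S).
-- Every element of OPT_{p+3} has weight at most 2^{p+3}·optα = 16τ, so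
-- w(OPT_{p+3}) ≤ 16τ |OPT_{p+3}| ≤ 32τ (d+1) |S| ≤ 32 (d+1)² f(S).
module Submission where

open import Defs
open import Data.Nat using (ℕ; suc; _*_)
open import Data.Nat.Logarithm using (⌈log₂_⌉)
open import Data.Integer as ℤ using (ℤ; +_)
open import Data.Rational as ℚ using (ℚ; 0ℚ; 1ℚ; _≤_)
open import Data.Fin.Subset using (Subset; ⊥; ∣_∣)
open import Data.Fin.Permutation using (Permutation′)
open import Relation.Binary.PropositionalEquality using (_≡_)

open import Data.Bool using (T; _∧_; if_then_else_)
open import Data.Bool.Properties using (T-∧; T-≡)
open import Data.Fin using (Fin; zero; suc)
open import Data.Fin.Subset using (_∈_; _⊆_; _∪_; _─_; ⁅_⁆; inside; outside)
open import Data.Fin.Subset.Properties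
  using (∣p∣≤∣x∷p∣; ∣⁅x⁆∣≡1; ∣⊥∣≡0; p⊆q⇒∣p∣≤∣q∣; ∪-comm; ∪-assoc; q⊆p∪q)
open import Data.Integer using (-[1+_])
import Data.Integer.Properties as ℤ
import Data.List as List
open import Data.List using (_∷_; foldr; allFin)
open import Data.List.Properties using (foldr-map; map-tabulate)
open import Data.List.Relation.Unary.Any as Any using ()
open import Data.List.Membership.Propositional using () renaming (_∈_ to _∈ₗ_)
open import Data.List.Membership.Propositional.Properties using (∈-allFin)
open import Data.Nat as ℕ using (zero; _⊔_; z≤n; s≤s)
import Data.Nat.Properties as ℕ
open import Data.Product using (_,_; proj₂)
open import Data.Rational using (½; _+_; NonNegative; Positive; nonNegative; positive; toℚᵘ)
  renaming (_*_ to _·_)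
open import Data.Rational.Properties
open import Data.Rational.Solver using (module +-*-Solver)
import Data.Rational.Unnormalised as ℚᵘ
import Data.Rational.Unnormalised.Properties as ℚᵘ
open import Data.Vec using (_∷_; []; lookup; here; there)
open import Data.Vec.Properties using (lookup∘tabulate; []=⇒lookup)
open import Function using (_∘_; id)
open import Function.Bundles using (Equivalence)
open import Relation.Binary.PropositionalEquality
  using (refl; sym; trans; cong; cong₂; module ≡-Reasoning)
open import Relation.Nullary.Decidable using (Dec; isYes; toWitness)

fromℕ : ℕ → ℚ
fromℕ a = + a ℚ./ 1

toℚᵘ-fromℕ : ∀ a → toℚᵘ (fromℕ a) ℚᵘ.≃ ℚᵘ.mkℚᵘ (+ a) 0
toℚᵘ-fromℕ a = toℚᵘ-fromℚᵘ (ℚᵘ.mkℚᵘ (+ a) 0)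

fromℕ-homo-+ : ∀ a b → fromℕ (a ℕ.+ b) ≡ fromℕ a + fromℕ b
fromℕ-homo-+ a b = toℚᵘ-injective (begin
  toℚᵘ (fromℕ (a ℕ.+ b))                        ≈⟨ toℚᵘ-fromℕ (a ℕ.+ b) ⟩
  ℚᵘ.mkℚᵘ (+ (a ℕ.+ b)) 0                       ≈⟨ ℚᵘ.*≡* (cong (ℤ._* + 1) integral) ⟩
  ℚᵘ.mkℚᵘ (+ a) 0 ℚᵘ.+ ℚᵘ.mkℚᵘ (+ b) 0          ≈⟨ ℚᵘ.+-cong (toℚᵘ-fromℕ a) (toℚᵘ-fromℕ b) ⟨
  toℚᵘ (fromℕ a) ℚᵘ.+ toℚᵘ (fromℕ b)            ≈⟨ toℚᵘ-homo-+ (fromℕ a) (fromℕ b) ⟨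
  toℚᵘ (fromℕ a + fromℕ b)                      ∎)
  where
  open ℚᵘ.≃-Reasoning
  integral : + (a ℕ.+ b) ≡ + a ℤ.* + 1 ℤ.+ + b ℤ.* + 1
  integral = trans (ℤ.pos-+ a b) (sym (cong₂ ℤ._+_ (ℤ.*-identityʳ (+ a)) (ℤ.*-identityʳ (+ b))))

fromℕ-homo-* : ∀ a b → fromℕ (a ℕ.* b) ≡ fromℕ a · fromℕ b
fromℕ-homo-* a b = toℚᵘ-injective (begin
  toℚᵘ (fromℕ (a ℕ.* b))                        ≈⟨ toℚᵘ-fromℕ (a ℕ.* b) ⟩
  ℚᵘ.mkℚᵘ (+ (a ℕ.* b)) 0                       ≈⟨ ℚᵘ.*≡* (cong (ℤ._* + 1) (ℤ.pos-* a b)) ⟩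
  ℚᵘ.mkℚᵘ (+ a) 0 ℚᵘ.* ℚᵘ.mkℚᵘ (+ b) 0          ≈⟨ ℚᵘ.*-cong (toℚᵘ-fromℕ a) (toℚᵘ-fromℕ b) ⟨
  toℚᵘ (fromℕ a) ℚᵘ.* toℚᵘ (fromℕ b)            ≈⟨ toℚᵘ-homo-* (fromℕ a) (fromℕ b) ⟨
  toℚᵘ (fromℕ a · fromℕ b)                      ∎)
  where open ℚᵘ.≃-Reasoning

fromℕ-mono-≤ : ∀ {a b} → a ℕ.≤ b → fromℕ a ≤ fromℕ b
fromℕ-mono-≤ {a} {b} a≤b = toℚᵘ-cancel-≤
  (ℚᵘ.≤-respˡ-≃ (ℚᵘ.≃-sym (toℚᵘ-fromℕ a)) (ℚᵘ.≤-respʳ-≃ (ℚᵘ.≃-sym (toℚᵘ-fromℕ b))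
    (ℚᵘ.*≤* (ℤ.*-monoʳ-≤-nonNeg (+ 1) (ℤ.+≤+ a≤b)))))

fromℕ-nonNeg : ∀ a → NonNegative (fromℕ a)
fromℕ-nonNeg a = normalize-nonNeg a 1

fromℕ-*-/ : ∀ a m .{{_ : ℕ.NonZero m}} → fromℕ m · (+ a ℚ./ m) ≡ fromℕ a
fromℕ-*-/ a m@(suc m-1) = toℚᵘ-injective (begin
  toℚᵘ (fromℕ m · (+ a ℚ./ m))                    ≈⟨ toℚᵘ-homo-* (fromℕ m) (+ a ℚ./ m) ⟩
  toℚᵘ (fromℕ m) ℚᵘ.* toℚᵘ (+ a ℚ./ m)            ≈⟨ ℚᵘ.*-cong (toℚᵘ-fromℕ m) (toℚᵘ-fromℚᵘ (ℚᵘ.mkℚᵘ (+ a) m-1)) ⟩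
  ℚᵘ.mkℚᵘ (+ m) 0 ℚᵘ.* ℚᵘ.mkℚᵘ (+ a) m-1          ≈⟨ ℚᵘ.*≡* cross ⟩
  ℚᵘ.mkℚᵘ (+ a) 0                                 ≈⟨ toℚᵘ-fromℕ a ⟨
  toℚᵘ (fromℕ a)                                  ∎)
  where
  open ℚᵘ.≃-Reasoning
  cross : (+ m ℤ.* + a) ℤ.* + 1 ≡ + a ℤ.* + (m ℕ.+ 0)
  cross = trans (ℤ.*-identityʳ (+ m ℤ.* + a))
                (trans (ℤ.*-comm (+ m) (+ a)) (cong (λ k → + a ℤ.* + k) (sym (ℕ.+-identityʳ m))))

pow2-suc : ∀ q → pow2 (q ℤ.+ + 1) ≡ fromℕ 2 · pow2 q
pow2-suc (+ m)            = cong pow2ℕ (ℕ.+-comm m 1)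
pow2-suc -[1+ zero ]      = refl
pow2-suc -[1+ suc m ]     = begin
  halfPow m                      ≡⟨ *-identityˡ (halfPow m) ⟨
  (fromℕ 2 · ½) · halfPow m      ≡⟨ *-assoc (fromℕ 2) ½ (halfPow m) ⟩
  fromℕ 2 · (½ · halfPow m)      ∎
  where open ≡-Reasoning

pow2-+3 : ∀ q → pow2 (q ℤ.+ + 3) ≡ fromℕ 8 · pow2 q
pow2-+3 q = begin
  pow2 (q ℤ.+ + 3)                                ≡⟨ cong pow2 q+3≡q+1+1+1 ⟩
  pow2 (((q ℤ.+ + 1) ℤ.+ + 1) ℤ.+ + 1)            ≡⟨ pow2-suc ((q ℤ.+ + 1) ℤ.+ + 1) ⟩
  fromℕ 2 · pow2 ((q ℤ.+ + 1) ℤ.+ + 1)            ≡⟨ cong (fromℕ 2 ·_) (pow2-suc (q ℤ.+ + 1)) ⟩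
  fromℕ 2 · (fromℕ 2 · pow2 (q ℤ.+ + 1))          ≡⟨ cong (λ x → fromℕ 2 · (fromℕ 2 · x)) (pow2-suc q) ⟩
  fromℕ 2 · (fromℕ 2 · (fromℕ 2 · pow2 q))        ≡⟨ *-assoc (fromℕ 2) (fromℕ 2) (fromℕ 2 · pow2 q) ⟨
  fromℕ 4 · (fromℕ 2 · pow2 q)                    ≡⟨ *-assoc (fromℕ 4) (fromℕ 2) (pow2 q) ⟨
  fromℕ 8 · pow2 q                                ∎
  where
  open ≡-Reasoning
  q+3≡q+1+1+1 : q ℤ.+ + 3 ≡ ((q ℤ.+ + 1) ℤ.+ + 1) ℤ.+ + 1
  q+3≡q+1+1+1 = sym (trans (ℤ.+-assoc (q ℤ.+ + 1) (+ 1) (+ 1)) (ℤ.+-assoc q (+ 1) (+ 2)))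

pow2ℕ-nonNeg : ∀ m → NonNegative (pow2ℕ m)
pow2ℕ-nonNeg zero    = _
pow2ℕ-nonNeg (suc m) = nonNeg*nonNeg⇒nonNeg (fromℕ 2) (pow2ℕ m) {{pow2ℕ-nonNeg m}}

halfPow-nonNeg : ∀ m → NonNegative (halfPow m)
halfPow-nonNeg zero    = _
halfPow-nonNeg (suc m) = nonNeg*nonNeg⇒nonNeg ½ (halfPow m) {{halfPow-nonNeg m}}

pow2-nonNeg : ∀ q → NonNegative (pow2 q)
pow2-nonNeg (+ m)    = pow2ℕ-nonNeg m
pow2-nonNeg -[1+ m ] = halfPow-nonNeg m

∣p∪q∣≤∣p∣+∣q∣ : ∀ {n} (p q : Subset n) → ∣ p ∪ q ∣ ℕ.≤ ∣ p ∣ ℕ.+ ∣ q ∣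
∣p∪q∣≤∣p∣+∣q∣ []            []            = z≤n
∣p∪q∣≤∣p∣+∣q∣ (outside ∷ p) (outside ∷ q) = ∣p∪q∣≤∣p∣+∣q∣ p q
∣p∪q∣≤∣p∣+∣q∣ (outside ∷ p) (inside  ∷ q) =
  ℕ.≤-trans (s≤s (∣p∪q∣≤∣p∣+∣q∣ p q)) (ℕ.≤-reflexive (sym (ℕ.+-suc ∣ p ∣ ∣ q ∣)))
∣p∪q∣≤∣p∣+∣q∣ (inside  ∷ p) (outside ∷ q) = s≤s (∣p∪q∣≤∣p∣+∣q∣ p q)
∣p∪q∣≤∣p∣+∣q∣ (inside  ∷ p) (inside  ∷ q) =
  s≤s (ℕ.≤-trans (∣p∪q∣≤∣p∣+∣q∣ p q) (ℕ.≤-trans (ℕ.n≤1+n _) (ℕ.≤-reflexive (sym (ℕ.+-suc ∣ p ∣ ∣ q ∣)))))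

∣p─q∣≤∣p∣ : ∀ {n} (p q : Subset n) → ∣ p ─ q ∣ ℕ.≤ ∣ p ∣
∣p─q∣≤∣p∣ []            []            = z≤n
∣p─q∣≤∣p∣ (x       ∷ p) (inside  ∷ q) = ℕ.≤-trans (∣p─q∣≤∣p∣ p q) (∣p∣≤∣x∷p∣ x p)
∣p─q∣≤∣p∣ (outside ∷ p) (outside ∷ q) = ∣p─q∣≤∣p∣ p q
∣p─q∣≤∣p∣ (inside  ∷ p) (outside ∷ q) = s≤s (∣p─q∣≤∣p∣ p q)

∣p∪q∪⁅x⁆∣≤∣p∣+1+∣q∣ : ∀ {n} (p q : Subset n) x → ∣ p ∪ q ∪ ⁅ x ⁆ ∣ ℕ.≤ ∣ p ∣ ℕ.+ suc ∣ q ∣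
∣p∪q∪⁅x⁆∣≤∣p∣+1+∣q∣ p q x = begin
  ∣ p ∪ q ∪ ⁅ x ⁆ ∣              ≤⟨ ∣p∪q∣≤∣p∣+∣q∣ p (q ∪ ⁅ x ⁆) ⟩
  ∣ p ∣ ℕ.+ ∣ q ∪ ⁅ x ⁆ ∣        ≤⟨ ℕ.+-monoʳ-≤ ∣ p ∣ (∣p∪q∣≤∣p∣+∣q∣ q ⁅ x ⁆) ⟩
  ∣ p ∣ ℕ.+ (∣ q ∣ ℕ.+ ∣ ⁅ x ⁆ ∣) ≡⟨ cong (λ k → ∣ p ∣ ℕ.+ (∣ q ∣ ℕ.+ k)) (∣⁅x⁆∣≡1 x) ⟩
  ∣ p ∣ ℕ.+ (∣ q ∣ ℕ.+ 1)        ≡⟨ cong (∣ p ∣ ℕ.+_) (ℕ.+-comm ∣ q ∣ 1) ⟩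
  ∣ p ∣ ℕ.+ suc ∣ q ∣            ∎
  where open ℕ.≤-Reasoning

≤-foldr-⊔ : ∀ {A : Set} (g : A → ℕ) {x} {xs} → x ∈ₗ xs → g x ℕ.≤ foldr (λ y m → g y ⊔ m) 0 xs
≤-foldr-⊔ g {xs = y ∷ xs} (Any.here refl) = ℕ.m≤m⊔n (g y) _
≤-foldr-⊔ g {xs = y ∷ xs} (Any.there x∈xs) = ℕ.≤-trans (≤-foldr-⊔ g x∈xs) (ℕ.m≤n⊔m (g y) _)

∣Dplus∣≤supDeg : ∀ {n} (f : Subset n → ℚ) u → ∣ Dplus f u ∣ ℕ.≤ supDeg f
∣Dplus∣≤supDeg f u = ≤-foldr-⊔ (λ v → ∣ Dplus f v ∣) (∈-allFin u)

sumOver-∷ : ∀ {n} x (T : Subset n) (g : Fin (suc n) → ℚ) →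
            sumOver (x ∷ T) g ≡ (if x then g zero + sumOver T (g ∘ suc) else sumOver T (g ∘ suc))
sumOver-∷ {n} x T g = cong (λ s → if x then g zero + s else s) (begin
  foldr step 0ℚ (List.tabulate suc)           ≡⟨ cong (foldr step 0ℚ) (map-tabulate id suc) ⟨
  foldr step 0ℚ (List.map suc (allFin n))     ≡⟨ foldr-map step suc 0ℚ (allFin n) ⟩
  sumOver T (g ∘ suc)                         ∎)
  where
  open ≡-Reasoning
  step : Fin (suc n) → ℚ → ℚ
  step u acc = if lookup (x ∷ T) u then g u + acc else acc

sumOver-≤ : ∀ {n} (T : Subset n) (g : Fin n → ℚ) B → (∀ {u} → u ∈ T → g u ≤ B) →
            sumOver T g ≤ fromℕ ∣ T ∣ · B
sumOver-≤ []            g B g≤B = ≤-reflexive (sym (*-zeroˡ B))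
sumOver-≤ (outside ∷ T) g B g≤B = begin
  sumOver (outside ∷ T) g                ≡⟨ sumOver-∷ outside T g ⟩
  sumOver T (g ∘ suc)                    ≤⟨ sumOver-≤ T (g ∘ suc) B (g≤B ∘ there) ⟩
  fromℕ ∣ T ∣ · B                        ∎
  where open ≤-Reasoning
sumOver-≤ (inside ∷ T) g B g≤B = begin
  sumOver (inside ∷ T) g                 ≡⟨ sumOver-∷ inside T g ⟩
  g zero + sumOver T (g ∘ suc)           ≤⟨ +-mono-≤ (g≤B here) (sumOver-≤ T (g ∘ suc) B (g≤B ∘ there)) ⟩
  B + fromℕ ∣ T ∣ · B                    ≡⟨ cong (_+ fromℕ ∣ T ∣ · B) (*-identityˡ B) ⟨
  1ℚ · B + fromℕ ∣ T ∣ · B               ≡⟨ *-distribʳ-+ B 1ℚ (fromℕ ∣ T ∣) ⟨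
  (1ℚ + fromℕ ∣ T ∣) · B                 ≡⟨ cong (_· B) (fromℕ-homo-+ 1 ∣ T ∣) ⟨
  fromℕ (suc ∣ T ∣) · B                  ∎
  where open ≤-Reasoning

OPTlevel-upper : ∀ {n} (f : Subset n → ℚ) π O optα q {u} →
                 u ∈ OPTlevel f π O optα q → wt f π O u ≤ pow2 q · optα
OPTlevel-upper f π O optα q {u} u∈ =
  toWitness {a? = upper?} (proj₂ (Equivalence.to (T-∧ {isYes lower?}) (proj₂ (Equivalence.to (T-∧ {lookup O u}) u∈O₃))))
  where
  lower? : Dec (pow2 q · optα · ½ ≤ wt f π O u)
  upper? : Dec (wt f π O u ≤ pow2 q · optα)
  lower? = pow2 q · optα · ½ ≤? wt f π O u
  upper? = wt f π O u ≤? pow2 q · optα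
  u∈O₃ : T (lookup O u ∧ isYes lower? ∧ isYes upper?)
  u∈O₃ = Equivalence.from T-≡ (trans (sym (lookup∘tabulate _ u)) ([]=⇒lookup u∈))

marg-gain : ∀ {n} {f : Subset n → ℚ} {τ} → Monotone f → ∀ u S D →
            τ ≤ marg f u (D ∪ S) → f S + τ ≤ f (S ∪ D ∪ ⁅ u ⁆)
marg-gain {f = f} {τ} mono u S D τ≤marg = begin
  f S + τ                                ≤⟨ +-mono-≤ (mono S (D ∪ S) (q⊆p∪q D S)) τ≤marg ⟩
  f (D ∪ S) + marg f u (D ∪ S)           ≡⟨ solve 2 (λ a b → a :+ (b :- a) := b) refl (f (D ∪ S)) (f ((D ∪ S) ∪ ⁅ u ⁆)) ⟩
  f ((D ∪ S) ∪ ⁅ u ⁆)                    ≡⟨ cong (λ X → f (X ∪ ⁅ u ⁆)) (∪-comm D S) ⟩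
  f ((S ∪ D) ∪ ⁅ u ⁆)                    ≡⟨ cong f (∪-assoc S D ⁅ u ⁆) ⟩
  f (S ∪ D ∪ ⁅ u ⁆)                      ∎
  where
  open ≤-Reasoning
  open +-*-Solver

GainPerElement : ∀ {n} → (Subset n → ℚ) → ℚ → Subset n → Set
GainPerElement f τ S = τ · fromℕ ∣ S ∣ ≤ fromℕ (suc (supDeg f)) · f S

module _ {n} {Indep : Subset n → Set} {f : Subset n → ℚ} {π : Permutation′ n} {τ : ℚ}
         (τ-nonNeg : NonNegative τ) (mono : Monotone f) where

  private
    d+1 : ℕ
    d+1 = suc (supDeg f)

  ∣S∪D∪⁅u⁆∣≤∣S∣+d+1 : ∀ u S D → D ⊆ Dplus f u ─ arrivedBy π u → ∣ S ∪ D ∪ ⁅ u ⁆ ∣ ℕ.≤ ∣ S ∣ ℕ.+ d+1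
  ∣S∪D∪⁅u⁆∣≤∣S∣+d+1 u S D D⊆ = ℕ.≤-trans (∣p∪q∪⁅x⁆∣≤∣p∣+1+∣q∣ S D u) (ℕ.+-monoʳ-≤ ∣ S ∣ (s≤s ∣D∣≤d))
    where
    ∣D∣≤d : ∣ D ∣ ℕ.≤ supDeg f
    ∣D∣≤d = ℕ.≤-trans (p⊆q⇒∣p∣≤∣q∣ D⊆) (ℕ.≤-trans (∣p─q∣≤∣p∣ (Dplus f u) (arrivedBy π u)) (∣Dplus∣≤supDeg f u))

  AlgStep-gainPerElement : ∀ {u S S′} → AlgStep Indep f π τ u S S′ →
                           GainPerElement f τ S → GainPerElement f τ S′
  AlgStep-gainPerElement (skip _) gain = gain
  AlgStep-gainPerElement {u} {S} (add D (D⊆ , τ≤marg , _)) gain = begin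
    τ · fromℕ ∣ S ∪ D ∪ ⁅ u ⁆ ∣                 ≤⟨ *-monoˡ-≤-nonNeg τ {{τ-nonNeg}} (fromℕ-mono-≤ (∣S∪D∪⁅u⁆∣≤∣S∣+d+1 u S D D⊆)) ⟩
    τ · fromℕ (∣ S ∣ ℕ.+ d+1)                   ≡⟨ cong (τ ·_) (fromℕ-homo-+ ∣ S ∣ d+1) ⟩
    τ · (fromℕ ∣ S ∣ + fromℕ d+1)               ≡⟨ *-distribˡ-+ τ (fromℕ ∣ S ∣) (fromℕ d+1) ⟩
    τ · fromℕ ∣ S ∣ + τ · fromℕ d+1             ≤⟨ +-mono-≤ gain (≤-reflexive (*-comm τ (fromℕ d+1))) ⟩
    fromℕ d+1 · f S + fromℕ d+1 · τ             ≡⟨ *-distribˡ-+ (fromℕ d+1) (f S) τ ⟨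
    fromℕ d+1 · (f S + τ)                       ≤⟨ *-monoˡ-≤-nonNeg (fromℕ d+1) {{fromℕ-nonNeg d+1}} (marg-gain mono u S D τ≤marg) ⟩
    fromℕ d+1 · f (S ∪ D ∪ ⁅ u ⁆)               ∎
    where open ≤-Reasoning

  AlgRun-gainPerElement : ∀ {us S S′} → AlgRun Indep f π τ us S S′ →
                          GainPerElement f τ S → GainPerElement f τ S′
  AlgRun-gainPerElement done          gain = gain
  AlgRun-gainPerElement (next step run) gain = AlgRun-gainPerElement run (AlgStep-gainPerElement step gain)

gainPerElement-⊥ : ∀ {n} (f : Subset n → ℚ) τ → NonNegative (f ⊥) → GainPerElement f τ ⊥
gainPerElement-⊥ {n} f τ f⊥-nonNeg = begin
  τ · fromℕ ∣ ⊥ {n} ∣                ≡⟨ cong (λ k → τ · fromℕ k) (∣⊥∣≡0 n) ⟩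
  τ · 0ℚ                              ≡⟨ *-zeroʳ τ ⟩
  0ℚ                                  ≤⟨ nonNegative⁻¹ _ {{nonNeg*nonNeg⇒nonNeg (fromℕ (suc (supDeg f))) {{fromℕ-nonNeg (suc (supDeg f))}} (f ⊥) {{f⊥-nonNeg}}}} ⟩
  fromℕ (suc (supDeg f)) · f ⊥       ∎
  where open ≤-Reasoning

0≤r*p⇒0≤p : ∀ r .{{_ : Positive r}} {p} → 0ℚ ≤ r · p → 0ℚ ≤ p
0≤r*p⇒0≤p r {p} 0≤rp = *-cancelˡ-≤-pos r (≤-trans (≤-reflexive (*-zeroʳ r)) 0≤rp)

/-≤⇒≤-* : ∀ a m .{{_ : ℕ.NonZero m}} {q} → + a ℚ./ m ≤ q → fromℕ a ≤ fromℕ m · q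
/-≤⇒≤-* a m {q} a/m≤q = begin
  fromℕ a                  ≡⟨ fromℕ-*-/ a m ⟨
  fromℕ m · (+ a ℚ./ m)    ≤⟨ *-monoˡ-≤-nonNeg (fromℕ m) {{fromℕ-nonNeg m}} a/m≤q ⟩
  fromℕ m · q              ∎
  where open ≤-Reasoning

≤-*⇒*-/-≤ : ∀ m .{{_ : ℕ.NonZero m}} {p q} → p ≤ fromℕ m · q → p · (+ 1 ℚ./ m) ≤ q
≤-*⇒*-/-≤ m {p} {q} p≤mq = begin
  p · (+ 1 ℚ./ m)                  ≤⟨ *-monoʳ-≤-nonNeg (+ 1 ℚ./ m) {{normalize-nonNeg 1 m}} p≤mq ⟩
  (fromℕ m · q) · (+ 1 ℚ./ m)      ≡⟨ cong (_· (+ 1 ℚ./ m)) (*-comm (fromℕ m) q) ⟩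
  (q · fromℕ m) · (+ 1 ℚ./ m)      ≡⟨ *-assoc q (fromℕ m) (+ 1 ℚ./ m) ⟩
  q · (fromℕ m · (+ 1 ℚ./ m))      ≡⟨ cong (q ·_) (fromℕ-*-/ 1 m) ⟩
  q · 1ℚ                           ≡⟨ *-identityʳ q ⟩
  q                                ∎
  where open ≤-Reasoning

pow2-+3-threshold : ∀ q o → pow2 (q ℤ.+ + 3) · o ≡ fromℕ 16 · (pow2 q · o · ½)
pow2-+3-threshold q o = begin
  pow2 (q ℤ.+ + 3) · o                   ≡⟨ cong (_· o) (pow2-+3 q) ⟩
  (fromℕ 8 · pow2 q) · o                 ≡⟨⟩
  ((fromℕ 16 · ½) · pow2 q) · o          ≡⟨ solve 4 (λ a h P o → ((a :* h) :* P) :* o := a :* (P :* o :* h)) refl (fromℕ 16) ½ (pow2 q) o ⟩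
  fromℕ 16 · (pow2 q · o · ½)            ∎
  where
  open ≡-Reasoning
  open +-*-Solver

threshold-count-bound : ∀ c s d τ F → NonNegative τ →
                        + c ℚ./ (2 ℕ.* suc d) ≤ fromℕ s → τ · fromℕ s ≤ fromℕ (suc d) · F →
                        fromℕ c · (fromℕ 16 · τ) ≤ fromℕ (32 ℕ.* (suc d ℕ.* suc d)) · F
threshold-count-bound c s d τ F τ-nonNeg c/2D≤s τs≤DF = begin
  fromℕ c · (fromℕ 16 · τ)               ≤⟨ *-monoʳ-≤-nonNeg (fromℕ 16 · τ) {{16τ-nonNeg}} (/-≤⇒≤-* c (2 ℕ.* D) c/2D≤s) ⟩
  (fromℕ (2 ℕ.* D) · fromℕ s) · (fromℕ 16 · τ)
                                         ≡⟨ solve 4 (λ a s b τ → (a :* s) :* (b :* τ) := (b :* a) :* (τ :* s)) refl (fromℕ (2 ℕ.* D)) (fromℕ s) (fromℕ 16) τ ⟩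
  (fromℕ 16 · fromℕ (2 ℕ.* D)) · (τ · fromℕ s)
                                         ≡⟨ cong (_· (τ · fromℕ s)) (trans (sym (fromℕ-homo-* 16 (2 ℕ.* D))) (cong fromℕ (sym (ℕ.*-assoc 16 2 D)))) ⟩
  fromℕ (32 ℕ.* D) · (τ · fromℕ s)       ≤⟨ *-monoˡ-≤-nonNeg (fromℕ (32 ℕ.* D)) {{fromℕ-nonNeg (32 ℕ.* D)}} τs≤DF ⟩
  fromℕ (32 ℕ.* D) · (fromℕ D · F)       ≡⟨ *-assoc (fromℕ (32 ℕ.* D)) (fromℕ D) F ⟨
  (fromℕ (32 ℕ.* D) · fromℕ D) · F       ≡⟨ cong (_· F) (trans (sym (fromℕ-homo-* (32 ℕ.* D) D)) (cong fromℕ (ℕ.*-assoc 32 D D))) ⟩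
  fromℕ (32 ℕ.* (D ℕ.* D)) · F           ∎
  where
  open ≤-Reasoning
  open +-*-Solver
  D : ℕ
  D = suc d
  16τ-nonNeg : NonNegative (fromℕ 16 · τ)
  16τ-nonNeg = nonNeg*nonNeg⇒nonNeg (fromℕ 16) τ {{τ-nonNeg}}

lemma2 : (n k : ℕ) (Indep : Subset n → Set) (f : Subset n → ℚ) (π : Permutation′ n)
         (OPT : Subset n) (α optα : ℚ) (cα p : ℤ) (S : Subset n) →
         IsMatroid Indep → HasRank Indep k →
         (∀ A → 0ℚ ≤ f A) → Monotone f → f ⊥ ≡ 0ℚ →
         IsOPT Indep f OPT →
         1ℚ ≤ α → f OPT ≤ α ℚ.* optα → optα ≤ f OPT →
         IsCeilLog2 α cα →
         (ℤ.- (+ ⌈log₂ k ⌉) ℤ.- + 3) ℤ.≤ p → p ℤ.≤ cα →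
         Algorithm1Output Indep f π optα p S →
         let d = supDeg f
             O₃ = OPTlevel f π OPT optα (p ℤ.+ + 3)
         in ((+ ∣ O₃ ∣) ℚ./ (2 * suc d)) ≤ ((+ ∣ S ∣) ℚ./ 1) →
            sumOver O₃ (wt f π OPT) ℚ.* ((+ 1) ℚ./ (32 * (suc d * suc d))) ≤ f S
lemma2 n k Indep f π OPT α optα cα p S _ _ f≥0 mono _ _ 1≤α fOPT≤α·optα _ _ _ _ run ∣O₃∣/2D≤∣S∣ =
  ≤-*⇒*-/-≤ (32 * (suc (supDeg f) * suc (supDeg f))) (begin
    sumOver O₃ (wt f π OPT)                    ≤⟨ sumOver-≤ O₃ (wt f π OPT) _ (OPTlevel-upper f π OPT optα (p ℤ.+ + 3)) ⟩
    fromℕ ∣ O₃ ∣ · (pow2 (p ℤ.+ + 3) · optα)   ≡⟨ cong (fromℕ ∣ O₃ ∣ ·_) (pow2-+3-threshold p optα) ⟩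
    fromℕ ∣ O₃ ∣ · (fromℕ 16 · τ)              ≤⟨ threshold-count-bound ∣ O₃ ∣ ∣ S ∣ (supDeg f) τ (f S) τ-nonNeg ∣O₃∣/2D≤∣S∣ gain ⟩
    fromℕ (32 * (suc (supDeg f) * suc (supDeg f))) · f S ∎)
  where
  open ≤-Reasoning
  O₃ : Subset n
  O₃ = OPTlevel f π OPT optα (p ℤ.+ + 3)
  τ : ℚ
  τ = pow2 p · optα · ½
  optα-nonNeg : NonNegative optα
  optα-nonNeg = nonNegative (0≤r*p⇒0≤p α {{positive (<-≤-trans (positive⁻¹ 1ℚ) 1≤α)}} (≤-trans (f≥0 OPT) fOPT≤α·optα))
  τ-nonNeg : NonNegative τ
  τ-nonNeg = nonNeg*nonNeg⇒nonNeg (pow2 p · optα) {{nonNeg*nonNeg⇒nonNeg (pow2 p) {{pow2-nonNeg p}} optα {{optα-nonNeg}}}} ½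
  gain : GainPerElement f τ S
  gain = AlgRun-gainPerElement τ-nonNeg mono run (gainPerElement-⊥ f τ (nonNegative (f≥0 ⊥)))
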